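{- Let $G$ be a $2$-connected graph and let $D=(P_0,\ldots,P_k)$ be a non-separating ear decomposition of $G$. Then for every $i\in\{0,\ldots,k\}$, the graph $\overline{G_i}$ is connected.
   Context: An ear decomposition of a $2$-connected graph $G$ is a sequence $(P_0,P_1,\ldots,P_k)$ of subgraphs of $G$ that partition $E(G)$ such that $P_0$ is a cycle and each $P_i$, $1\le i\le k$, is a path that intersects $P_0\cup\cdots\cup P_{i-1}$ in exactly its two endpoints. The inner vertices of a path are its vertices other than its endpoints; every vertex of the cycle $P_0$ counts as an inner vertex of $P_0$. Write $G_i=P_0\cup\cdots\cup P_i$, $\overline{V_i}=V(G)-V(G_i)$, and $\overline{G_i}$ for the subgraph of $G$ induced by $\overline{V_i}$ (the empty graph is considered connected). The ear decomposition is non-separating if for every $i$, every inner vertex of $P_i$ has a neighbor in $\overline{G_i}$ unless $\overline{G_i}$ is empty. -}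

module Defs where

open import Data.Nat using (ℕ; zero; suc; _≤_; _<_)
open import Data.Fin using (Fin; toℕ) renaming (zero to fzero; suc to fsuc)
open import Data.Bool using (Bool; true; false)
open import Data.List using (List; []; _∷_; _++_; [_]; length; head; last)
open import Data.List.Membership.Propositional using (_∈_)
open import Data.List.Relation.Unary.Unique.Propositional using (Unique)
open import Data.Maybe using (just)
open import Data.Product using (Σ; ∃; ∃-syntax; _×_; _,_)
open import Data.Sum using (_⊎_)
open import Data.Unit using (⊤)
open import Data.Empty using (⊥)
open import Relation.Nullary using (¬_)
open import Relation.Binary.PropositionalEquality using (_≡_; _≢_)

record Graph : Set where
  field
    n      : ℕ
    adj    : Fin n → Fin n → Bool
    sym    : ∀ u v → adj u v ≡ adj v u
    irrefl : ∀ v → adj v v ≡ false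

module _ (G : Graph) where
  open Graph G

  V : Set
  V = Fin n

  Adj : V → V → Set
  Adj u v = adj u v ≡ true

  data WalkIn (S : V → Set) : V → V → Set where
    stop : ∀ {v} → S v → WalkIn S v v
    step : ∀ {u w v} → S u → Adj u w → WalkIn S w v → WalkIn S u v

  -- the subgraph of G induced by S is connected (the empty graph is connected)
  ConnectedOn : (V → Set) → Set
  ConnectedOn S = ∀ u v → S u → S v → WalkIn S u v

  TwoConnected : Set
  TwoConnected =
    3 ≤ n × ConnectedOn (λ _ → ⊤) × (∀ w → ConnectedOn (λ x → x ≢ w))

  Chain : List V → Set
  Chain []            = ⊤
  Chain (x ∷ [])      = ⊤
  Chain (x ∷ y ∷ r)   = Adj x y × Chain (y ∷ r)

  data ConsecPair : List V → V → V → Set where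
    here  : ∀ {x y r} → ConsecPair (x ∷ y ∷ r) x y
    there : ∀ {z r x y} → ConsecPair r x y → ConsecPair (z ∷ r) x y

  EdgeAlong : List V → V → V → Set
  EdgeAlong p u v = ConsecPair p u v ⊎ ConsecPair p v u

  closed : List V → List V
  closed []      = []
  closed (x ∷ r) = x ∷ (r ++ [ x ])

  IsCycle : List V → Set
  IsCycle c = Unique c × 3 ≤ length c × Chain (closed c)

  IsPath : List V → Set
  IsPath p = Unique p × 2 ≤ length p × Chain p

  Endpoint : List V → V → Set
  Endpoint p x = head p ≡ just x ⊎ last p ≡ just x

  module Ears (k : ℕ) (ear : Fin (suc k) → List V) where

    -- list whose consecutive pairs are the edges of P_i
    earWalk : Fin (suc k) → List V
    earWalk fzero    = closed (ear fzero)
    earWalk (fsuc j) = ear (fsuc j)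

    InEarlier : Fin (suc k) → V → Set
    InEarlier i x = ∃[ j ] (toℕ j < toℕ i × x ∈ ear j)

    InGi : Fin (suc k) → V → Set
    InGi i x = ∃[ j ] (toℕ j ≤ toℕ i × x ∈ ear j)

    -- x ∈ V̄_i = V(G) - V(G_i)
    Outside : Fin (suc k) → V → Set
    Outside i x = ¬ InGi i x

    -- inner vertices of P_i (all vertices for the cycle P_0)
    Inner : Fin (suc k) → V → Set
    Inner fzero    x = x ∈ ear fzero
    Inner (fsuc j) x = x ∈ ear (fsuc j) × ¬ Endpoint (ear (fsuc j)) x

  -- ear decomposition (P_0, ..., P_k): ear 0 is a cycle (cyclic vertex list),
  -- the other ears are paths (vertex lists)
  record EarDecomposition : Set where
    field
      k   : ℕ
      ear : Fin (suc k) → List V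
    open Ears k ear public
    field
      cycle0   : IsCycle (ear fzero)
      paths    : ∀ j → IsPath (ear (fsuc j))
      attach   : ∀ j x → x ∈ ear (fsuc j) →
                   (InEarlier (fsuc j) x → Endpoint (ear (fsuc j)) x) ×
                   (Endpoint (ear (fsuc j)) x → InEarlier (fsuc j) x)
      -- the ears partition E(G)
      edgesOK  : ∀ i u v → EdgeAlong (earWalk i) u v → Adj u v
      covers   : ∀ u v → Adj u v → ∃[ i ] EdgeAlong (earWalk i) u v
      disjoint : ∀ i j u v → EdgeAlong (earWalk i) u v →
                   EdgeAlong (earWalk j) u v → i ≡ j

  NonSeparating : EarDecomposition → Set
  NonSeparating D =
    ∀ i x → Inner i x →
      (∃[ y ] (Outside i y × Adj x y)) ⊎ (∀ y → ¬ Outside i y)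
    where open EarDecomposition D

-- V̄_i is the disjoint union of V̄_{i+1} and the inner vertices of P_{i+1}. Going down from
-- i = k, where V̄_k is empty because 2-connectivity puts every vertex on an edge and hence
-- on an ear, V̄_{i+1} is connected by induction, the inner vertices of P_{i+1} are connected
-- along the path itself, and the non-separating condition joins each of them to V̄_{i+1}.
module Submission where

open import Defs
open import Data.Fin using (Fin; toℕ; fromℕ; inject₁; punchIn) renaming (zero to fzero; suc to fsuc)
open import Data.Fin.Properties using (punchInᵢ≢i; ≤fromℕ; ≤∧≢⇒<; toℕ-inject₁; _≟_)
open import Data.Fin.Induction using (>-weakInduction)
open import Data.Nat using (suc; _≤_; s≤s)
open import Data.Nat.Properties using (<⇒≤)
open import Data.List using (List; []; _∷_; last)
open import Data.List.Membership.Propositional using (_∈_)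
open import Data.List.Membership.Propositional.Properties using (∈-++⁻)
open import Data.List.Relation.Unary.Any using (here; there)
open import Data.List.Relation.Unary.All as All using ()
open import Data.List.Relation.Unary.AllPairs using (_∷_)
open import Data.List.Relation.Unary.Unique.Propositional using (Unique)
open import Data.Maybe using (just)
open import Data.Maybe.Properties using (just-injective)
open import Data.Product using (∃-syntax; _×_; _,_; proj₁; proj₂)
open import Data.Sum using (_⊎_; inj₁; inj₂; [_,_]′)
open import Data.Empty using (⊥-elim)
open import Function using (_∘_)
open import Relation.Nullary using (¬_; yes; no)
open import Relation.Binary.PropositionalEquality using (_≡_; _≢_; refl; sym; trans; subst)

last-∈ : ∀ {A : Set} (xs : List A) {z} → last xs ≡ just z → z ∈ xs
last-∈ (x ∷ [])     refl = here refl
last-∈ (x ∷ y ∷ xs) eq   = there (last-∈ (y ∷ xs) eq)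

another-element : ∀ {m} → 2 ≤ m → (x : Fin m) → ∃[ w ] (w ≢ x)
another-element (s≤s (s≤s _)) x = punchIn x fzero , punchInᵢ≢i x fzero

module GraphProperties (G : Graph) where

  Adj-sym : ∀ {u v} → Adj G u v → Adj G v u
  Adj-sym {u} {v} = trans (Graph.sym G v u)

  WalkIn-map : ∀ {P Q : V G → Set} → (∀ {x} → P x → Q x) →
               ∀ {u v} → WalkIn G P u v → WalkIn G Q u v
  WalkIn-map f (stop pv)       = stop (f pv)
  WalkIn-map f (step pu u~w w) = step (f pu) u~w (WalkIn-map f w)

  WalkIn-source : ∀ {P u v} → WalkIn G P u v → P u
  WalkIn-source (stop pu)     = pu
  WalkIn-source (step pu _ _) = pu

  _++ʷ_ : ∀ {P u w v} → WalkIn G P u w → WalkIn G P w v → WalkIn G P u v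
  stop _          ++ʷ w′ = w′
  step pu u~x w   ++ʷ w′ = step pu u~x (w ++ʷ w′)

  WalkIn-reverse : ∀ {P u v} → WalkIn G P u v → WalkIn G P v u
  WalkIn-reverse (stop pv)       = stop pv
  WalkIn-reverse (step pu u~w w) =
    WalkIn-reverse w ++ʷ step (WalkIn-source w) (Adj-sym u~w) (stop pu)

  WalkIn-first-edge : ∀ {P u v} → WalkIn G P u v → u ≢ v → ∃[ y ] Adj G u y
  WalkIn-first-edge (stop _)       u≢u = ⊥-elim (u≢u refl)
  WalkIn-first-edge (step _ u~y _) _   = _ , u~y

  ConnectedOn-attach : {S T I : V G → Set} →
    (∀ {x} → S x → T x ⊎ I x) → (∀ {x} → T x → S x) → (∀ {x} → I x → S x) →
    ConnectedOn G T → ConnectedOn G I →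
    (∀ x → I x → (∃[ y ] (T y × Adj G x y)) ⊎ (∀ y → ¬ T y)) →
    ConnectedOn G S
  ConnectedOn-attach {S} {T} {I} split T⊆S I⊆S T-conn I-conn attached = connected
    where
    I→T : ∀ {u v} → I u → T v → WalkIn G S u v
    I→T {u} {v} iu tv with attached u iu
    ... | inj₁ (y , ty , u~y) = step (I⊆S iu) u~y (WalkIn-map T⊆S (T-conn y v ty tv))
    ... | inj₂ T-empty        = ⊥-elim (T-empty v tv)

    connected : ConnectedOn G S
    connected u v su sv with split su | split sv
    ... | inj₁ tu | inj₁ tv = WalkIn-map T⊆S (T-conn u v tu tv)
    ... | inj₁ tu | inj₂ iv = WalkIn-reverse (I→T iv tu)
    ... | inj₂ iu | inj₁ tv = I→T iu tv
    ... | inj₂ iu | inj₂ iv = WalkIn-map I⊆S (I-conn u v iu iv)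

  PathInner : List (V G) → V G → Set
  PathInner p x = x ∈ p × ¬ Endpoint G p x

  chain-walk-from-head : ∀ {P} a r → Chain G (a ∷ r) → Unique (a ∷ r) →
    (∀ {y} → y ∈ a ∷ r → last (a ∷ r) ≢ just y → P y) →
    ∀ {x} → x ∈ a ∷ r → last (a ∷ r) ≢ just x → WalkIn G P a x
  chain-walk-from-head a r       _           _          inner (here refl) x≢last =
    stop (inner (here refl) x≢last)
  chain-walk-from-head a (b ∷ r) (a~b , ch) (a∉ ∷ uniq) inner (there x∈) x≢last =
    step (inner (here refl) a≢last) a~b
         (chain-walk-from-head b r ch uniq (inner ∘ there) x∈ x≢last)
    where
    a≢last : last (b ∷ r) ≢ just a
    a≢last eq = All.lookup a∉ (last-∈ (b ∷ r) eq) refl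

  PathInner-connected : ∀ p → IsPath G p → ConnectedOn G (PathInner p)
  PathInner-connected (e ∷ []) (_ , s≤s () , _)
  PathInner-connected (e ∷ a ∷ r) (e∉ ∷ uniq , _ , _ , ch) u v iu iv =
    WalkIn-reverse (from-a iu) ++ʷ from-a iv
    where
    inner : ∀ {y} → y ∈ a ∷ r → last (a ∷ r) ≢ just y → PathInner (e ∷ a ∷ r) y
    inner y∈ y≢last = there y∈ , λ
      { (inj₁ head≡y) → All.lookup e∉ y∈ (just-injective head≡y)
      ; (inj₂ last≡y) → y≢last last≡y }

    from-a : ∀ {x} → PathInner (e ∷ a ∷ r) x → WalkIn G (PathInner (e ∷ a ∷ r)) a x
    from-a (here refl , ¬end) = ⊥-elim (¬end (inj₁ refl))
    from-a (there x∈  , ¬end) = chain-walk-from-head a r ch uniq inner x∈ (¬end ∘ inj₂)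

  has-neighbour : TwoConnected G → ∀ x → ∃[ y ] Adj G x y
  has-neighbour (3≤n , conn , _) x with another-element (<⇒≤ 3≤n) x
  ... | w , w≢x = WalkIn-first-edge (conn x w _ _) (w≢x ∘ sym)

  ConsecPair-∈ˡ : ∀ {p x y} → ConsecPair G p x y → x ∈ p
  ConsecPair-∈ˡ here      = here refl
  ConsecPair-∈ˡ (there c) = there (ConsecPair-∈ˡ c)

  ConsecPair-∈ʳ : ∀ {p x y} → ConsecPair G p x y → y ∈ p
  ConsecPair-∈ʳ here      = there (here refl)
  ConsecPair-∈ʳ (there c) = there (ConsecPair-∈ʳ c)

  EdgeAlong-∈ : ∀ {p x y} → EdgeAlong G p x y → x ∈ p
  EdgeAlong-∈ = [ ConsecPair-∈ˡ , ConsecPair-∈ʳ ]′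

  closed-∈ : ∀ c {x} → x ∈ closed G c → x ∈ c
  closed-∈ (a ∷ r) (here x≡a) = here x≡a
  closed-∈ (a ∷ r) (there x∈) with ∈-++⁻ r x∈
  ... | inj₁ x∈r        = there x∈r
  ... | inj₂ (here x≡a) = here x≡a

module EarDecompositionProperties (G : Graph) (D : EarDecomposition G) where
  open GraphProperties G
  open EarDecomposition D
  open import Data.List.Membership.DecPropositional (_≟_ {Graph.n G}) using (_∈?_)

  earWalk-∈ : ∀ i {x} → x ∈ earWalk i → x ∈ ear i
  earWalk-∈ fzero    = closed-∈ (ear fzero)
  earWalk-∈ (fsuc j) x∈ = x∈

  InGi-last : TwoConnected G → ∀ x → InGi (fromℕ k) x
  InGi-last tc x with has-neighbour tc x
  ... | y , x~y with covers x y x~y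
  ...   | i , edge = i , ≤fromℕ i , earWalk-∈ i (EdgeAlong-∈ edge)

  module _ (j : Fin k) {x : V G} where

    InEarlier⇒InGi : InEarlier (fsuc j) x → InGi (inject₁ j) x
    InEarlier⇒InGi (j′ , s≤s j′≤j , x∈) = j′ , subst (toℕ j′ ≤_) (sym (toℕ-inject₁ j)) j′≤j , x∈

    InGi⇒InEarlier : InGi (inject₁ j) x → InEarlier (fsuc j) x
    InGi⇒InEarlier (j′ , j′≤j , x∈) = j′ , s≤s (subst (toℕ j′ ≤_) (toℕ-inject₁ j) j′≤j) , x∈

    InGi-suc⁻ : InGi (fsuc j) x → InEarlier (fsuc j) x ⊎ x ∈ ear (fsuc j)
    InGi-suc⁻ (j′ , j′≤1+j , x∈) with j′ ≟ fsuc j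
    ... | yes refl = inj₂ x∈
    ... | no  j′≢1+j = inj₁ (j′ , ≤∧≢⇒< j′≤1+j j′≢1+j , x∈)

    Outside-suc⇒Outside : Outside (fsuc j) x → Outside (inject₁ j) x
    Outside-suc⇒Outside out g with InGi⇒InEarlier g
    ... | j′ , j′<1+j , x∈ = out (j′ , <⇒≤ j′<1+j , x∈)

    Inner⇒Outside : Inner (fsuc j) x → Outside (inject₁ j) x
    Inner⇒Outside (x∈ , ¬end) g = ¬end (proj₁ (attach j x x∈) (InGi⇒InEarlier g))

    Outside-split : Outside (inject₁ j) x → Outside (fsuc j) x ⊎ Inner (fsuc j) x
    Outside-split out with x ∈? ear (fsuc j)
    ... | yes x∈ = inj₂ (x∈ , out ∘ InEarlier⇒InGi ∘ proj₂ (attach j x x∈))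
    ... | no  x∉ = inj₁ (λ g → [ out ∘ InEarlier⇒InGi , x∉ ]′ (InGi-suc⁻ g))

lemma5 : (G : Graph) → TwoConnected G → (D : EarDecomposition G) →
    NonSeparating G D →
    (i : Fin (suc (EarDecomposition.k D))) →
    ConnectedOn G (EarDecomposition.Outside D i)
lemma5 G tc D ns = >-weakInduction (ConnectedOn G ∘ Outside) last-empty outside-step
  where
  open GraphProperties G
  open EarDecomposition D
  open EarDecompositionProperties G D

  last-empty : ConnectedOn G (Outside (fromℕ k))
  last-empty u _ out _ = ⊥-elim (out (InGi-last tc u))

  outside-step : ∀ j → ConnectedOn G (Outside (fsuc j)) → ConnectedOn G (Outside (inject₁ j))
  outside-step j conn =
    ConnectedOn-attach (Outside-split j) (Outside-suc⇒Outside j) (Inner⇒Outside j)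
      conn (PathInner-connected (ear (fsuc j)) (paths j)) (ns (fsuc j))
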